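{- $\mathsf{ICK}$ is sound and complete with respect to the class of all conditional Kripke frames: for every formula $\phi$, $\phi\in\mathsf{ICK}$ iff $\phi$ is valid on every conditional Kripke frame.
   Context: Formulas: $\phi::=p\mid\bot\mid\phi\wedge\phi\mid\phi\vee\phi\mid\phi\to\phi\mid\phi>\phi$, $\top:=\bot\to\bot$. $\mathsf{ICK}$ is the smallest set of formulas containing the axioms of intuitionistic propositional logic, $(p>(q\wedge r))\leftrightarrow((p>q)\wedge(p>r))$ and $(p>\top)\leftrightarrow\top$, closed under uniform substitution, modus ponens and the rules: from $\phi\leftrightarrow\psi$ infer $(\phi>\chi)\leftrightarrow(\psi>\chi)$ and $(\chi>\phi)\leftrightarrow(\chi>\psi)$. A conditional Kripke frame is $(X,\le,\mathcal R)$ with $(X,\le)$ a nonempty preorder and $\mathcal R=\{R_a: a\text{ an upset of }(X,\le)\}$ binary relations indexed by all upsets, such that for each upset $a$: if $x\le y$ and $yR_az$ then $xR_aw$ and $w\le z$ for some $w$. A valuation maps variables to upsets; truth: standard intuitionistic Kripke clauses ($x\models\phi\to\psi$ iff every $y\ge x$ satisfying $\phi$ satisfies $\psi$; $\bot$ never holds) and $x\models\phi>\psi$ iff every $y$ with $xR_{V(\phi)}y$ satisfies $\psi$, $V(\phi)$ being the truth set of $\phi$. Validity on a frame: true at all worlds under all valuations. -}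

module Defs where

open import Level using (Level; Setω; _⊔_; Lift; lift) renaming (suc to lsuc; zero to lzero)
open import Data.Nat using (ℕ)
open import Data.Product using (Σ; _×_; _,_; proj₁; proj₂)
open import Data.Sum using (_⊎_; inj₁; inj₂)
open import Data.Empty using (⊥)

infixr 6 _∧_
infixr 5 _∨_
infixr 4 _⇒_
infixr 4 _▷_
infix 3 _⇔_

data Form : Set where
  var : ℕ → Form
  ⊥'  : Form
  _∧_ : Form → Form → Form
  _∨_ : Form → Form → Form
  _⇒_ : Form → Form → Form
  _▷_ : Form → Form → Form

⊤' : Form
⊤' = ⊥' ⇒ ⊥'

_⇔_ : Form → Form → Form
φ ⇔ ψ = (φ ⇒ ψ) ∧ (ψ ⇒ φ)

Subst : Set
Subst = ℕ → Form

_[_] : Form → Subst → Form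
var n [ σ ] = σ n
⊥' [ σ ] = ⊥'
(φ ∧ ψ) [ σ ] = (φ [ σ ]) ∧ (ψ [ σ ])
(φ ∨ ψ) [ σ ] = (φ [ σ ]) ∨ (ψ [ σ ])
(φ ⇒ ψ) [ σ ] = (φ [ σ ]) ⇒ (ψ [ σ ])
(φ ▷ ψ) [ σ ] = (φ [ σ ]) ▷ (ψ [ σ ])

p q r : Form
p = var 0
q = var 1
r = var 2

data ICK : Form → Set where
  ax-K   : ∀ φ ψ → ICK (φ ⇒ (ψ ⇒ φ))
  ax-S   : ∀ φ ψ χ → ICK ((φ ⇒ (ψ ⇒ χ)) ⇒ ((φ ⇒ ψ) ⇒ (φ ⇒ χ)))
  ax-∧₁  : ∀ φ ψ → ICK ((φ ∧ ψ) ⇒ φ)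
  ax-∧₂  : ∀ φ ψ → ICK ((φ ∧ ψ) ⇒ ψ)
  ax-∧I  : ∀ φ ψ → ICK (φ ⇒ (ψ ⇒ (φ ∧ ψ)))
  ax-∨₁  : ∀ φ ψ → ICK (φ ⇒ (φ ∨ ψ))
  ax-∨₂  : ∀ φ ψ → ICK (ψ ⇒ (φ ∨ ψ))
  ax-∨E  : ∀ φ ψ χ → ICK ((φ ⇒ χ) ⇒ ((ψ ⇒ χ) ⇒ ((φ ∨ ψ) ⇒ χ)))
  ax-⊥   : ∀ φ → ICK (⊥' ⇒ φ)
  ax-C∧  : ICK ((p ▷ (q ∧ r)) ⇔ ((p ▷ q) ∧ (p ▷ r)))
  ax-C⊤  : ICK ((p ▷ ⊤') ⇔ ⊤')
  sub    : ∀ {φ} (σ : Subst) → ICK φ → ICK (φ [ σ ])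
  mp     : ∀ {φ ψ} → ICK (φ ⇒ ψ) → ICK φ → ICK ψ
  congˡ  : ∀ {φ ψ} χ → ICK (φ ⇔ ψ) → ICK ((φ ▷ χ) ⇔ (ψ ▷ χ))
  congʳ  : ∀ {φ ψ} χ → ICK (φ ⇔ ψ) → ICK ((χ ▷ φ) ⇔ (χ ▷ ψ))

record Frame (ℓ : Level) : Set (lsuc ℓ) where
  field
    X        : Set ℓ
    _≤_      : X → X → Set ℓ
    ≤-refl   : ∀ {x} → x ≤ x
    ≤-trans  : ∀ {x y z} → x ≤ y → y ≤ z → x ≤ z
    point    : X

  IsUpset : (X → Set ℓ) → Set ℓ
  IsUpset a = ∀ {x y} → x ≤ y → a x → a y

  Upset : Set (lsuc ℓ)
  Upset = Σ (X → Set ℓ) IsUpset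

  field
    R        : Upset → X → X → Set ℓ
    -- R is indexed by upsets as *sets*: upsets with the same members
    -- index the same relation
    R-ext    : ∀ (a b : Upset) →
               (∀ x → (proj₁ a x → proj₁ b x) × (proj₁ b x → proj₁ a x)) →
               ∀ x y → R a x y → R b x y
    R-back   : ∀ (a : Upset) {x y z} → x ≤ y → R a y z →
               Σ X (λ w → R a x w × w ≤ z)

module Semantics {ℓ : Level} (F : Frame ℓ) where
  open Frame F

  Valuation : Set (lsuc ℓ)
  Valuation = ℕ → Upset

  module _ (V : Valuation) where
    mutual
      _⊨_ : X → Form → Set ℓ
      x ⊨ var n = proj₁ (V n) x
      x ⊨ ⊥' = Lift ℓ ⊥
      x ⊨ (φ ∧ ψ) = (x ⊨ φ) × (x ⊨ ψ)
      x ⊨ (φ ∨ ψ) = (x ⊨ φ) ⊎ (x ⊨ ψ)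
      x ⊨ (φ ⇒ ψ) = ∀ y → x ≤ y → y ⊨ φ → y ⊨ ψ
      x ⊨ (φ ▷ ψ) = ∀ y → R (truthSet φ) x y → y ⊨ ψ

      truthSet : Form → Upset
      truthSet φ = (λ x → x ⊨ φ) , mono φ

      mono : ∀ φ → IsUpset (λ x → x ⊨ φ)
      mono (var n) x≤y h = proj₂ (V n) x≤y h
      mono ⊥' x≤y h = h
      mono (φ ∧ ψ) x≤y (h₁ , h₂) = mono φ x≤y h₁ , mono ψ x≤y h₂
      mono (φ ∨ ψ) x≤y (inj₁ h) = inj₁ (mono φ x≤y h)
      mono (φ ∨ ψ) x≤y (inj₂ h) = inj₂ (mono ψ x≤y h)
      mono (φ ⇒ ψ) x≤y h z y≤z hz = h z (≤-trans x≤y y≤z) hz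
      mono (φ ▷ ψ) x≤y h z yRz with R-back (truthSet φ) x≤y yRz
      ... | w , xRw , w≤z = mono ψ w≤z (h w xRw)

  ValidOn : Form → Set (lsuc ℓ)
  ValidOn φ = ∀ (V : Valuation) (x : X) → _⊨_ V x φ

Valid : Form → Setω
Valid φ = ∀ {ℓ} (F : Frame ℓ) → Semantics.ValidOn F φ

record _↔ω_ {a : Level} (A : Set a) (B : Setω) : Setω where
  field
    to   : A → B
    from : B → A

-- For completeness of ψ we build
-- a finite canonical model whose worlds are Boolean assignments to the
-- subformulas of ψ.  An assignment is refuted when some sequent rule, read
-- backwards at a subformula, closes it; the unrefuted ones play the role of
-- prime theories.  A U-successor of y makes true the consequent b′ of every
-- conditional a′ ▷ b′ of y whose antecedent a′ defines U on unrefuted worlds.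
-- Hence y falsifies a ▷ b exactly when b does not follow from the consequents
-- of those conditionals of y whose antecedents are provably equivalent to a,
-- which is a question about formulas of smaller conditional depth.  So,
-- constructively, the model for ψ needs ICK to be decidable below the depth of
-- ψ, and completeness and decidability are proved together by induction on
-- depth.
module Submission where

open import Defs
open import Level using (Level; lift) renaming (zero to lzero)
open import Function using (_∘_; id)
open import Data.Bool using (Bool; true; false)
open import Data.Bool.Properties using (¬-not) renaming (_≟_ to _≟ᵇ_)
open import Data.Nat using (ℕ; zero; suc; _≤_; _<_; _⊔_; z≤n; s≤s) renaming (_≟_ to _≟ℕ_)
import Data.Nat.Properties as ℕ
open import Data.Product as Product using (∃-syntax; _×_; _,_; proj₁; proj₂; uncurry; map₁; map₂)
open import Data.Sum as Sum using (_⊎_; inj₁; inj₂)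
open import Data.Empty using (⊥; ⊥-elim)
open import Data.List using (List; []; _∷_; _++_; length; filter)
open import Data.List.Properties using (++-identityʳ)
open import Data.List.Relation.Unary.All as All using (All; []; _∷_; all?)
open import Data.List.Relation.Unary.All.Properties using (¬All⇒Any¬)
open import Data.List.Relation.Unary.Any using (here; there)
open import Data.List.Membership.Propositional using (_∈_; find)
open import Data.List.Membership.Propositional.Properties
  using (∈-++⁺ˡ; ∈-++⁺ʳ; ∈-++⁻; ∈-filter⁺; ∈-filter⁻)
open import Data.List.Relation.Binary.Subset.Propositional using (_⊆_)
open import Data.List.Relation.Binary.Subset.Propositional.Properties
  using (⊆-trans; ⊆-reflexive-↭; xs⊆xs++ys; xs⊆ys++xs; ++⁺ʳ; ∈-∷⁺ʳ)
open import Data.List.Relation.Binary.Permutation.Propositional.Properties using (shift)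
open import Relation.Nullary using (Dec; yes; no; ¬_; contradiction)
open import Relation.Nullary.Decidable using (_×-dec_; _⊎-dec_; map′)
open import Relation.Binary.Definitions using (DecidableEquality)
open import Relation.Binary.PropositionalEquality using (_≡_; _≢_; refl; sym; trans; cong; cong₂; subst; subst₂)

module Soundness {ℓ : Level} (F : Frame ℓ) where
  open Frame F
  open Semantics F

  _⟨_⟩ : Valuation → Subst → Valuation
  (V ⟨ σ ⟩) n = truthSet V (σ n)

  mutual
    ⊨-subst⁺ : ∀ V σ φ {x} → _⊨_ (V ⟨ σ ⟩) x φ → _⊨_ V x (φ [ σ ])
    ⊨-subst⁺ V σ (var n) h = h
    ⊨-subst⁺ V σ ⊥' h = h
    ⊨-subst⁺ V σ (a ∧ b) (ha , hb) = ⊨-subst⁺ V σ a ha , ⊨-subst⁺ V σ b hb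
    ⊨-subst⁺ V σ (a ∨ b) (inj₁ ha) = inj₁ (⊨-subst⁺ V σ a ha)
    ⊨-subst⁺ V σ (a ∨ b) (inj₂ hb) = inj₂ (⊨-subst⁺ V σ b hb)
    ⊨-subst⁺ V σ (a ⇒ b) h y x≤y ha = ⊨-subst⁺ V σ b (h y x≤y (⊨-subst⁻ V σ a ha))
    ⊨-subst⁺ V σ (a ▷ b) h y xRy =
      ⊨-subst⁺ V σ b (h y (R-ext _ _ (λ w → ⊨-subst⁻ V σ a , ⊨-subst⁺ V σ a) _ y xRy))

    ⊨-subst⁻ : ∀ V σ φ {x} → _⊨_ V x (φ [ σ ]) → _⊨_ (V ⟨ σ ⟩) x φ
    ⊨-subst⁻ V σ (var n) h = h
    ⊨-subst⁻ V σ ⊥' h = h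
    ⊨-subst⁻ V σ (a ∧ b) (ha , hb) = ⊨-subst⁻ V σ a ha , ⊨-subst⁻ V σ b hb
    ⊨-subst⁻ V σ (a ∨ b) (inj₁ ha) = inj₁ (⊨-subst⁻ V σ a ha)
    ⊨-subst⁻ V σ (a ∨ b) (inj₂ hb) = inj₂ (⊨-subst⁻ V σ b hb)
    ⊨-subst⁻ V σ (a ⇒ b) h y x≤y ha = ⊨-subst⁻ V σ b (h y x≤y (⊨-subst⁺ V σ a ha))
    ⊨-subst⁻ V σ (a ▷ b) h y xRy =
      ⊨-subst⁻ V σ b (h y (R-ext _ _ (λ w → ⊨-subst⁺ V σ a , ⊨-subst⁻ V σ a) _ y xRy))

  ⇔-at : ∀ V φ ψ {w} → _⊨_ V w (φ ⇔ ψ) → (_⊨_ V w φ → _⊨_ V w ψ) × (_⊨_ V w ψ → _⊨_ V w φ)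
  ⇔-at V φ ψ {w} (f , g) = f w ≤-refl , g w ≤-refl

  ICK-sound : ∀ {φ} → ICK φ → ValidOn φ
  ICK-sound (ax-K φ ψ) V x y _ hy z y≤z _ = mono V φ y≤z hy
  ICK-sound (ax-S φ ψ χ) V x y _ h z y≤z g w z≤w hw = h w (≤-trans y≤z z≤w) hw w ≤-refl (g w z≤w hw)
  ICK-sound (ax-∧₁ φ ψ) V x y _ h = proj₁ h
  ICK-sound (ax-∧₂ φ ψ) V x y _ h = proj₂ h
  ICK-sound (ax-∧I φ ψ) V x y _ h z y≤z g = mono V φ y≤z h , g
  ICK-sound (ax-∨₁ φ ψ) V x y _ h = inj₁ h
  ICK-sound (ax-∨₂ φ ψ) V x y _ h = inj₂ h
  ICK-sound (ax-∨E φ ψ χ) V x y _ f z y≤z g w z≤w (inj₁ h) = f w (≤-trans y≤z z≤w) h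
  ICK-sound (ax-∨E φ ψ χ) V x y _ f z y≤z g w z≤w (inj₂ h) = g w z≤w h
  ICK-sound (ax-⊥ φ) V x y _ (lift ())
  ICK-sound ax-C∧ V x =
    (λ y _ h → (λ z yRz → proj₁ (h z yRz)) , (λ z yRz → proj₂ (h z yRz))) ,
    (λ y _ h z yRz → proj₁ h z yRz , proj₂ h z yRz)
  ICK-sound ax-C⊤ V x = (λ y _ h z _ e → e) , (λ y _ h z _ w _ e → e)
  ICK-sound (sub {φ} σ d) V x = ⊨-subst⁺ V σ φ (ICK-sound d _ x)
  ICK-sound (mp d e) V x = ICK-sound d V x x ≤-refl (ICK-sound e V x)
  ICK-sound (congˡ {φ} {ψ} χ d) V x =
    (λ y _ h z yRz → h z (R-ext _ _ (λ w → Product.swap (⇔-at V φ ψ (ICK-sound d V w))) y z yRz)) ,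
    (λ y _ h z yRz → h z (R-ext _ _ (λ w → ⇔-at V φ ψ (ICK-sound d V w)) y z yRz))
  ICK-sound (congʳ {φ} {ψ} χ d) V x =
    (λ y _ h z yRz → proj₁ (⇔-at V φ ψ (ICK-sound d V z)) (h z yRz)) ,
    (λ y _ h z yRz → proj₂ (⇔-at V φ ψ (ICK-sound d V z)) (h z yRz))

infix 2 _⊢_
data _⊢_ (Γ : List Form) : Form → Set where
  hyp : ∀ {φ} → φ ∈ Γ → Γ ⊢ φ
  thm : ∀ {φ} → ICK φ → Γ ⊢ φ
  app : ∀ {φ ψ} → Γ ⊢ φ ⇒ ψ → Γ ⊢ φ → Γ ⊢ ψ

ICK-refl : ∀ φ → ICK (φ ⇒ φ)
ICK-refl φ = mp (mp (ax-S φ (φ ⇒ φ) φ) (ax-K φ (φ ⇒ φ))) (ax-K φ φ)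

deduction : ∀ {Γ φ ψ} → φ ∷ Γ ⊢ ψ → Γ ⊢ φ ⇒ ψ
deduction (hyp (here refl)) = thm (ICK-refl _)
deduction (hyp (there m)) = app (thm (ax-K _ _)) (hyp m)
deduction (thm t) = app (thm (ax-K _ _)) (thm t)
deduction (app d e) = app (app (thm (ax-S _ _ _)) (deduction d)) (deduction e)

⊢-trans : ∀ {Γ Δ ψ} → (∀ {φ} → φ ∈ Γ → Δ ⊢ φ) → Γ ⊢ ψ → Δ ⊢ ψ
⊢-trans f (hyp m) = f m
⊢-trans f (thm t) = thm t
⊢-trans f (app d e) = app (⊢-trans f d) (⊢-trans f e)

⊢-weaken : ∀ {Γ Δ ψ} → Γ ⊆ Δ → Γ ⊢ ψ → Δ ⊢ ψ
⊢-weaken Γ⊆Δ = ⊢-trans (hyp ∘ Γ⊆Δ)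

[]⊢⇒ICK : ∀ {φ} → [] ⊢ φ → ICK φ
[]⊢⇒ICK (thm t) = t
[]⊢⇒ICK (app d e) = mp ([]⊢⇒ICK d) ([]⊢⇒ICK e)

module _ {Γ : List Form} where
  ∧-intro : ∀ {a b} → Γ ⊢ a → Γ ⊢ b → Γ ⊢ a ∧ b
  ∧-intro d e = app (app (thm (ax-∧I _ _)) d) e

  ∧-elimˡ : ∀ {a b} → Γ ⊢ a ∧ b → Γ ⊢ a
  ∧-elimˡ = app (thm (ax-∧₁ _ _))

  ∧-elimʳ : ∀ {a b} → Γ ⊢ a ∧ b → Γ ⊢ b
  ∧-elimʳ = app (thm (ax-∧₂ _ _))

  ∨-introˡ : ∀ {a b} → Γ ⊢ a → Γ ⊢ a ∨ b
  ∨-introˡ = app (thm (ax-∨₁ _ _))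

  ∨-introʳ : ∀ {a b} → Γ ⊢ b → Γ ⊢ a ∨ b
  ∨-introʳ = app (thm (ax-∨₂ _ _))

  ∨-elim : ∀ {a b c} → Γ ⊢ a ∨ b → Γ ⊢ a ⇒ c → Γ ⊢ b ⇒ c → Γ ⊢ c
  ∨-elim d f g = app (app (app (thm (ax-∨E _ _ _)) f) g) d

  explode : ∀ {c} → Γ ⊢ ⊥' → Γ ⊢ c
  explode = app (thm (ax-⊥ _))

⋁ : List Form → Form
⋁ [] = ⊥'
⋁ (φ ∷ Δ) = φ ∨ ⋁ Δ

⋀ : List Form → Form
⋀ [] = ⊤'
⋀ (φ ∷ Λ) = φ ∧ ⋀ Λ

⋁-intro : ∀ {Γ Δ φ} → φ ∈ Δ → Γ ⊢ φ → Γ ⊢ ⋁ Δ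
⋁-intro (here refl) d = ∨-introˡ d
⋁-intro (there m) d = ∨-introʳ (⋁-intro m d)

⋁-mono : ∀ {Γ} Δ {Δ′} → Δ ⊆ Δ′ → Γ ⊢ ⋁ Δ → Γ ⊢ ⋁ Δ′
⋁-mono [] _ d = explode d
⋁-mono (φ ∷ Δ) Δ⊆Δ′ d =
  ∨-elim d (deduction (⋁-intro (Δ⊆Δ′ (here refl)) (hyp (here refl))))
           (deduction (⋁-mono Δ (Δ⊆Δ′ ∘ there) (hyp (here refl))))

⋁-singleton : ∀ {Γ φ} → Γ ⊢ ⋁ (φ ∷ []) → Γ ⊢ φ
⋁-singleton d = ∨-elim d (thm (ICK-refl _)) (thm (ax-⊥ _))

⋀-elim : ∀ {Γ Λ φ} → φ ∈ Λ → Γ ⊢ ⋀ Λ → Γ ⊢ φ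
⋀-elim (here refl) d = ∧-elimˡ d
⋀-elim (there m) d = ⋀-elim m (∧-elimʳ d)

⋀-deduction : ∀ {Λ φ} → Λ ⊢ φ → ICK (⋀ Λ ⇒ φ)
⋀-deduction d = []⊢⇒ICK (deduction (⊢-trans (λ m → ⋀-elim m (hyp (here refl))) d))

⊢⋁-weaken : ∀ {Γ Γ′ Δ Δ′} → Γ ⊆ Γ′ → Δ ⊆ Δ′ → Γ ⊢ ⋁ Δ → Γ′ ⊢ ⋁ Δ′
⊢⋁-weaken {Δ = Δ} Γ⊆Γ′ Δ⊆Δ′ = ⊢-weaken Γ⊆Γ′ ∘ ⋁-mono Δ Δ⊆Δ′

⊢⋁-cut : ∀ {Γ Δ φ} → φ ∷ Γ ⊢ ⋁ Δ → Γ ⊢ ⋁ (φ ∷ Δ) → Γ ⊢ ⋁ Δ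
⊢⋁-cut d e = ∨-elim e (deduction d) (thm (ICK-refl _))

ICK-⇔-intro : ∀ {a b} → ICK (a ⇒ b) → ICK (b ⇒ a) → ICK (a ⇔ b)
ICK-⇔-intro t u = []⊢⇒ICK (∧-intro (thm t) (thm u))

pqr≔ : Form → Form → Form → Subst
pqr≔ a b c zero = a
pqr≔ a b c (suc zero) = b
pqr≔ a b c (suc (suc zero)) = c
pqr≔ a b c (suc (suc (suc n))) = var n

▷-mono : ∀ a {b c} → ICK (b ⇒ c) → ICK ((a ▷ b) ⇒ (a ▷ c))
▷-mono a {b} {c} t =
  []⊢⇒ICK (deduction (∧-elimʳ (app (thm ▷-split) (app (∧-elimˡ (thm (congʳ a b⇔b∧c))) (hyp (here refl))))))
  where
  b⇔b∧c : ICK (b ⇔ (b ∧ c))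
  b⇔b∧c = ICK-⇔-intro ([]⊢⇒ICK (deduction (∧-intro (hyp (here refl)) (app (thm t) (hyp (here refl))))))
                      (ax-∧₁ b c)

  ▷-split : ICK ((a ▷ (b ∧ c)) ⇒ ((a ▷ b) ∧ (a ▷ c)))
  ▷-split = mp (ax-∧₁ _ _) (sub (pqr≔ a b c) ax-C∧)

▷-⋀ : ∀ {Γ} a Λ → (∀ {φ} → φ ∈ Λ → Γ ⊢ a ▷ φ) → Γ ⊢ a ▷ ⋀ Λ
▷-⋀ a [] f = app (∧-elimʳ (thm (sub (pqr≔ a a a) ax-C⊤))) (thm (ICK-refl ⊥'))
▷-⋀ a (φ ∷ Λ) f =
  app (∧-elimʳ (thm (sub (pqr≔ a φ (⋀ Λ)) ax-C∧))) (∧-intro (f (here refl)) (▷-⋀ a Λ (f ∘ there)))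

▷-congˡ : ∀ {Γ a a′ b} → ICK (a ⇔ a′) → Γ ⊢ a′ ▷ b → Γ ⊢ a ▷ b
▷-congˡ {b = b} t = app (∧-elimʳ (thm (congˡ b t)))

_≟F_ : DecidableEquality Form
var m ≟F var n = map′ (cong var) (λ { refl → refl }) (m ≟ℕ n)
⊥' ≟F ⊥' = yes refl
(a ∧ b) ≟F (c ∧ d) = map′ (uncurry (cong₂ _∧_)) (λ { refl → refl , refl }) (a ≟F c ×-dec b ≟F d)
(a ∨ b) ≟F (c ∨ d) = map′ (uncurry (cong₂ _∨_)) (λ { refl → refl , refl }) (a ≟F c ×-dec b ≟F d)
(a ⇒ b) ≟F (c ⇒ d) = map′ (uncurry (cong₂ _⇒_)) (λ { refl → refl , refl }) (a ≟F c ×-dec b ≟F d)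
(a ▷ b) ≟F (c ▷ d) = map′ (uncurry (cong₂ _▷_)) (λ { refl → refl , refl }) (a ≟F c ×-dec b ≟F d)
var _ ≟F ⊥' = no λ ()
var _ ≟F (_ ∧ _) = no λ ()
var _ ≟F (_ ∨ _) = no λ ()
var _ ≟F (_ ⇒ _) = no λ ()
var _ ≟F (_ ▷ _) = no λ ()
⊥' ≟F var _ = no λ ()
⊥' ≟F (_ ∧ _) = no λ ()
⊥' ≟F (_ ∨ _) = no λ ()
⊥' ≟F (_ ⇒ _) = no λ ()
⊥' ≟F (_ ▷ _) = no λ ()
(_ ∧ _) ≟F var _ = no λ ()
(_ ∧ _) ≟F ⊥' = no λ ()
(_ ∧ _) ≟F (_ ∨ _) = no λ ()
(_ ∧ _) ≟F (_ ⇒ _) = no λ ()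
(_ ∧ _) ≟F (_ ▷ _) = no λ ()
(_ ∨ _) ≟F var _ = no λ ()
(_ ∨ _) ≟F ⊥' = no λ ()
(_ ∨ _) ≟F (_ ∧ _) = no λ ()
(_ ∨ _) ≟F (_ ⇒ _) = no λ ()
(_ ∨ _) ≟F (_ ▷ _) = no λ ()
(_ ⇒ _) ≟F var _ = no λ ()
(_ ⇒ _) ≟F ⊥' = no λ ()
(_ ⇒ _) ≟F (_ ∧ _) = no λ ()
(_ ⇒ _) ≟F (_ ∨ _) = no λ ()
(_ ⇒ _) ≟F (_ ▷ _) = no λ ()
(_ ▷ _) ≟F var _ = no λ ()
(_ ▷ _) ≟F ⊥' = no λ ()
(_ ▷ _) ≟F (_ ∧ _) = no λ ()
(_ ▷ _) ≟F (_ ∨ _) = no λ ()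
(_ ▷ _) ≟F (_ ⇒ _) = no λ ()

depth : Form → ℕ
depth (var _) = 0
depth ⊥' = 0
depth (a ∧ b) = depth a ⊔ depth b
depth (a ∨ b) = depth a ⊔ depth b
depth (a ⇒ b) = depth a ⊔ depth b
depth (a ▷ b) = suc (depth a ⊔ depth b)

mutual
  Sub : Form → List Form
  Sub φ = φ ∷ Sub⁺ φ

  Sub⁺ : Form → List Form
  Sub⁺ (var _) = []
  Sub⁺ ⊥' = []
  Sub⁺ (a ∧ b) = Sub a ++ Sub b
  Sub⁺ (a ∨ b) = Sub a ++ Sub b
  Sub⁺ (a ⇒ b) = Sub a ++ Sub b
  Sub⁺ (a ▷ b) = Sub a ++ Sub b

Sub⁺-left : ∀ a b → a ∈ Sub a ++ Sub b
Sub⁺-left a b = ∈-++⁺ˡ {ys = Sub b} (here refl)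

Sub⁺-right : ∀ a b → b ∈ Sub a ++ Sub b
Sub⁺-right a b = ∈-++⁺ʳ (Sub a) (here refl)

mutual
  Sub-trans : ∀ φ {χ} → χ ∈ Sub φ → Sub χ ⊆ Sub φ
  Sub-trans φ (here refl) = id
  Sub-trans (a ∧ b) (there m) = there ∘ Sub-trans-++ a b m
  Sub-trans (a ∨ b) (there m) = there ∘ Sub-trans-++ a b m
  Sub-trans (a ⇒ b) (there m) = there ∘ Sub-trans-++ a b m
  Sub-trans (a ▷ b) (there m) = there ∘ Sub-trans-++ a b m

  Sub-trans-++ : ∀ a b {χ} → χ ∈ Sub a ++ Sub b → Sub χ ⊆ Sub a ++ Sub b
  Sub-trans-++ a b m with ∈-++⁻ (Sub a) m
  ... | inj₁ ma = ⊆-trans (Sub-trans a ma) (xs⊆xs++ys (Sub a) (Sub b))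
  ... | inj₂ mb = ⊆-trans (Sub-trans b mb) (xs⊆ys++xs (Sub b) (Sub a))

mutual
  depth-Sub : ∀ φ {χ} → χ ∈ Sub φ → depth χ ≤ depth φ
  depth-Sub φ (here refl) = ℕ.≤-refl
  depth-Sub (a ∧ b) (there m) = depth-Sub-++ a b m
  depth-Sub (a ∨ b) (there m) = depth-Sub-++ a b m
  depth-Sub (a ⇒ b) (there m) = depth-Sub-++ a b m
  depth-Sub (a ▷ b) (there m) = ℕ.m≤n⇒m≤1+n (depth-Sub-++ a b m)

  depth-Sub-++ : ∀ a b {χ} → χ ∈ Sub a ++ Sub b → depth χ ≤ depth a ⊔ depth b
  depth-Sub-++ a b m with ∈-++⁻ (Sub a) m
  ... | inj₁ ma = ℕ.≤-trans (depth-Sub a ma) (ℕ.m≤m⊔n _ _)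
  ... | inj₂ mb = ℕ.≤-trans (depth-Sub b mb) (ℕ.m≤n⊔m _ _)

⊔-<-lub : ∀ {m n o} → m < o → n < o → m ⊔ n < o
⊔-<-lub = ℕ.⊔-lub

depth-⋀ : ∀ {n} Λ → 0 < n → (∀ {φ} → φ ∈ Λ → depth φ < n) → depth (⋀ Λ) < n
depth-⋀ [] 0<n _ = 0<n
depth-⋀ (φ ∷ Λ) 0<n bound = ⊔-<-lub (bound (here refl)) (depth-⋀ Λ 0<n (bound ∘ there))

Assignment : Set
Assignment = Form → Bool

Agree : List Form → Assignment → Assignment → Set
Agree xs y z = ∀ {x} → x ∈ xs → y x ≡ z x

_⊑[_]_ : Assignment → List Form → Assignment → Set
y ⊑[ xs ] z = ∀ {x} → x ∈ xs → y x ≡ true → z x ≡ true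

valued : Bool → Assignment → List Form → List Form
valued v y = filter (λ x → y x ≟ᵇ v)

∈-valued⁺ : ∀ {v} y {xs x} → x ∈ xs → y x ≡ v → x ∈ valued v y xs
∈-valued⁺ {v} y = ∈-filter⁺ (λ x → y x ≟ᵇ v)

∈-valued⁻ : ∀ {v} y xs {x} → x ∈ valued v y xs → x ∈ xs × y x ≡ v
∈-valued⁻ {v} y xs = ∈-filter⁻ (λ x → y x ≟ᵇ v) {xs = xs}

valued-⊆ : ∀ v y xs → valued v y xs ⊆ xs
valued-⊆ v y xs = proj₁ ∘ ∈-valued⁻ y xs

valued-agree : ∀ {v y z} xs → Agree xs y z → valued v y xs ≡ valued v z xs
valued-agree [] _ = refl
valued-agree {v} {y} {z} (x ∷ xs) ag with y x | z x | ag (here refl)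
... | b | .b | refl with b ≟ᵇ v
...   | yes _ = cong (x ∷_) (valued-agree xs (ag ∘ there))
...   | no _ = valued-agree xs (ag ∘ there)

falses-mono : ∀ {y z} xs → y ⊑[ xs ] z → length (valued false z xs) ≤ length (valued false y xs)
falses-mono [] _ = z≤n
falses-mono {y} {z} (x ∷ xs) y⊑z with y x in yx | z x in zx
... | true | true = falses-mono xs (y⊑z ∘ there)
... | true | false = contradiction (trans (sym (y⊑z (here refl) yx)) zx) λ ()
... | false | true = ℕ.m≤n⇒m≤1+n (falses-mono xs (y⊑z ∘ there))
... | false | false = s≤s (falses-mono xs (y⊑z ∘ there))

falses-< : ∀ {y z a} xs → y ⊑[ xs ] z → a ∈ xs → y a ≡ false → z a ≡ true →
           length (valued false z xs) < length (valued false y xs)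
falses-< (x ∷ xs) y⊑z (here refl) ya za rewrite ya | za = s≤s (falses-mono xs (y⊑z ∘ there))
falses-< {y} {z} (x ∷ xs) y⊑z (there m) ya za with y x in yx | z x in zx
... | true | true = falses-< xs (y⊑z ∘ there) m ya za
... | true | false = contradiction (trans (sym (y⊑z (here refl) yx)) zx) λ ()
... | false | true = ℕ.m≤n⇒m≤1+n (falses-< xs (y⊑z ∘ there) m ya za)
... | false | false = s≤s (falses-< xs (y⊑z ∘ there) m ya za)

_[_≔_] : Assignment → Form → Bool → Assignment
(z [ χ ≔ b ]) x with x ≟F χ
... | yes _ = b
... | no _ = z x

update-cases : ∀ {z χ b v x xs} → (z [ χ ≔ b ]) x ≡ v → x ∈ χ ∷ xs →
               (x ≡ χ × b ≡ v) ⊎ (x ∈ xs × z x ≡ v)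
update-cases {χ = χ} {x = x} e m with x ≟F χ | m
... | yes x≡χ | _ = inj₁ (x≡χ , e)
... | no x≢χ | here x≡χ = ⊥-elim (x≢χ x≡χ)
... | no _ | there m′ = inj₂ (m′ , e)

valued-update : ∀ {v} z χ b xs → valued v (z [ χ ≔ b ]) (χ ∷ xs) ⊆ χ ∷ valued v z xs
valued-update z χ b xs m with ∈-valued⁻ (z [ χ ≔ b ]) (χ ∷ xs) m
... | m′ , e with update-cases e m′
...   | inj₁ (refl , _) = here refl
...   | inj₂ (m″ , e′) = there (∈-valued⁺ z m″ e′)

valued-update-≢ : ∀ {v} z χ b xs → b ≢ v → valued v (z [ χ ≔ b ]) (χ ∷ xs) ⊆ valued v z xs
valued-update-≢ z χ b xs b≢v m with ∈-valued⁻ (z [ χ ≔ b ]) (χ ∷ xs) m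
... | m′ , e with update-cases e m′
...   | inj₁ (_ , b≡v) = ⊥-elim (b≢v b≡v)
...   | inj₂ (m″ , e′) = ∈-valued⁺ z m″ e′

update-agree : ∀ {z z′ χ b} xs → Agree xs z z′ → Agree (χ ∷ xs) (z [ χ ≔ b ]) (z′ [ χ ≔ b ])
update-agree {χ = χ} _ ag {x} m with x ≟F χ | m
... | yes _ | _ = refl
... | no x≢χ | here x≡χ = ⊥-elim (x≢χ x≡χ)
... | no _ | there m′ = ag m′

update-self : ∀ z χ x → (z [ χ ≔ z χ ]) x ≡ z x
update-self z χ x with x ≟F χ
... | yes refl = refl
... | no _ = refl

assignment-search : ∀ xs {Q : Assignment → Set} → (∀ z → Dec (Q z)) →
                    (∀ {z z′} → Agree xs z z′ → Q z → Q z′) →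
                    (∀ z → Q z) ⊎ ∃[ z ] ¬ Q z
assignment-search [] Q? Q-agree with Q? (λ _ → true)
... | yes q = inj₁ λ z → Q-agree (λ ()) q
... | no ¬q = inj₂ (_ , ¬q)
assignment-search (χ ∷ xs) {Q} Q? Q-agree
  with assignment-search xs (λ z → Q? (z [ χ ≔ true ])) (λ ag → Q-agree (update-agree xs ag))
     | assignment-search xs (λ z → Q? (z [ χ ≔ false ])) (λ ag → Q-agree (update-agree xs ag))
... | inj₂ (_ , ¬q) | _ = inj₂ (_ , ¬q)
... | inj₁ _ | inj₂ (_ , ¬q) = inj₂ (_ , ¬q)
... | inj₁ q-true | inj₁ q-false = inj₁ λ z → Q-agree (λ {x} _ → update-self z χ x) (q-at-χ z)
  where
  q-at-χ : ∀ z → Q (z [ χ ≔ z χ ])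
  q-at-χ z with z χ
  ... | true = q-true z
  ... | false = q-false z

⊢-by-cases : ∀ xs Γ Δ → (∀ z → Γ ++ valued true z xs ⊢ ⋁ (Δ ++ valued false z xs)) → Γ ⊢ ⋁ Δ
⊢-by-cases [] Γ Δ H = subst₂ (λ Γ′ Δ′ → Γ′ ⊢ ⋁ Δ′) (++-identityʳ Γ) (++-identityʳ Δ) (H λ _ → true)
⊢-by-cases (χ ∷ xs) Γ Δ H = ⊢⋁-cut (⊢-by-cases xs (χ ∷ Γ) Δ χ-true) (⊢-by-cases xs Γ (χ ∷ Δ) χ-false)
  where
  χ-true : ∀ z → χ ∷ Γ ++ valued true z xs ⊢ ⋁ (Δ ++ valued false z xs)
  χ-true z = ⊢⋁-weaken (⊆-trans (++⁺ʳ Γ (valued-update z χ true xs)) (⊆-reflexive-↭ (shift χ Γ _)))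
                       (++⁺ʳ Δ (valued-update-≢ z χ true xs λ ()))
                       (H (z [ χ ≔ true ]))
  χ-false : ∀ z → Γ ++ valued true z xs ⊢ ⋁ (χ ∷ Δ ++ valued false z xs)
  χ-false z = ⊢⋁-weaken (++⁺ʳ Γ (valued-update-≢ z χ false xs λ ()))
                        (⊆-trans (++⁺ʳ Δ (valued-update z χ false xs)) (⊆-reflexive-↭ (shift χ Δ _)))
                        (H (z [ χ ≔ false ]))

Sat : List Form → List Form → Assignment → Set
Sat Γ Δ z = All (λ x → z x ≡ true) Γ × All (λ x → z x ≡ false) Δ

Sat? : ∀ Γ Δ z → Dec (Sat Γ Δ z)
Sat? Γ Δ z = all? (λ x → z x ≟ᵇ true) Γ ×-dec all? (λ x → z x ≟ᵇ false) Δ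

Sat-agree : ∀ {xs Γ Δ z z′} → Γ ⊆ xs → Δ ⊆ xs → Agree xs z z′ → Sat Γ Δ z → Sat Γ Δ z′
Sat-agree {xs} Γ⊆xs Δ⊆xs ag (sΓ , sΔ) = transport Γ⊆xs sΓ , transport Δ⊆xs sΔ
  where
  transport : ∀ {v ys} → ys ⊆ xs → All (λ x → _ ≡ v) ys → All (λ x → _ ≡ v) ys
  transport ys⊆xs s = All.tabulate λ m → trans (sym (ag (ys⊆xs m))) (All.lookup s m)

⊢-by-satisfying : ∀ xs {Γ Δ} → Γ ⊆ xs → Δ ⊆ xs →
                  (∀ z → Sat Γ Δ z → valued true z xs ⊢ ⋁ (valued false z xs)) → Γ ⊢ ⋁ Δ
⊢-by-satisfying xs {Γ} {Δ} Γ⊆xs Δ⊆xs H = ⊢-by-cases xs Γ Δ sequent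
  where
  sequent : ∀ z → Γ ++ valued true z xs ⊢ ⋁ (Δ ++ valued false z xs)
  sequent z with all? (λ x → z x ≟ᵇ true) Γ | all? (λ x → z x ≟ᵇ false) Δ
  ... | no ¬sΓ | _ with find (¬All⇒Any¬ (λ x → z x ≟ᵇ true) Γ ¬sΓ)
  ...   | _ , m , zx≢true = ⋁-intro (∈-++⁺ʳ Δ (∈-valued⁺ z (Γ⊆xs m) (¬-not zx≢true))) (hyp (∈-++⁺ˡ m))
  sequent z | yes _ | no ¬sΔ with find (¬All⇒Any¬ (λ x → z x ≟ᵇ false) Δ ¬sΔ)
  ...   | _ , m , zx≢false = ⋁-intro (∈-++⁺ˡ m) (hyp (∈-++⁺ʳ Γ (∈-valued⁺ z (Δ⊆xs m) (¬-not zx≢false))))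
  sequent z | yes sΓ | yes sΔ = ⊢⋁-weaken (xs⊆ys++xs _ Γ) (xs⊆ys++xs _ Δ) (H z (sΓ , sΔ))

any∈? : ∀ {A : Set} {P : A → Set} xs → (∀ {x} → x ∈ xs → Dec (P x)) → Dec (∃[ x ] x ∈ xs × P x)
any∈? [] _ = no λ ()
any∈? (x ∷ xs) P? with P? (here refl) | any∈? xs (P? ∘ there)
... | yes p | _ = yes (x , here refl , p)
... | no _ | yes (x′ , m , p) = yes (x′ , there m , p)
... | no ¬p | no ¬rest = no λ { (_ , here refl , p) → ¬p p
                              ; (x′ , there m , p) → ¬rest (x′ , m , p) }

module Canonical (ψ : Form) (ICK-below? : ∀ χ → depth χ < depth ψ → Dec (ICK χ)) where

  S : List Form
  S = Sub ψ

  ∈S⁺ : ∀ {χ x} → χ ∈ S → x ∈ Sub⁺ χ → x ∈ S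
  ∈S⁺ m k = Sub-trans ψ m (there k)

  depth-▷ : ∀ {a b} → (a ▷ b) ∈ S → depth a < depth ψ × depth b < depth ψ
  depth-▷ {a} {b} m = ℕ.m⊔n<o⇒m<o (depth a) (depth b) (depth-Sub ψ m) ,
                      ℕ.m⊔n<o⇒n<o (depth a) (depth b) (depth-Sub ψ m)

  depth-⇔ : ∀ {a b a′ b′} → (a ▷ b) ∈ S → (a′ ▷ b′) ∈ S → depth (a ⇔ a′) < depth ψ
  depth-⇔ m m′ = ⊔-<-lub (⊔-<-lub da da′) (⊔-<-lub da′ da)
    where da = proj₁ (depth-▷ m) ; da′ = proj₁ (depth-▷ m′)

  -- The depth bound lets the oracle decide Equivalent; it always holds for
  -- antecedents of conditionals in S (depth-⇔).
  Equivalent : Form → Form → Set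
  Equivalent a a′ = depth (a ⇔ a′) < depth ψ × ICK (a ⇔ a′)

  equivalent? : ∀ a a′ → Dec (Equivalent a a′)
  equivalent? a a′ with depth (a ⇔ a′) ℕ.<? depth ψ
  ... | yes d = map′ (d ,_) proj₂ (ICK-below? _ d)
  ... | no ¬d = no (¬d ∘ proj₁)

  consequent : Form → Form → List Form
  consequent a (a′ ▷ b′) with equivalent? a a′
  ... | yes _ = b′ ∷ []
  ... | no _ = []
  consequent a _ = []

  consequents : Form → List Form → List Form
  consequents a [] = []
  consequents a (x ∷ Γ) = consequent a x ++ consequents a Γ

  ∈-consequent⁻ : ∀ {a b} x → b ∈ consequent a x → ∃[ a′ ] x ≡ (a′ ▷ b) × Equivalent a a′
  ∈-consequent⁻ {a} (a′ ▷ b′) m with equivalent? a a′ | m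
  ... | yes eq | here refl = a′ , refl , eq
  ... | no _ | ()
  ∈-consequent⁻ (var _) ()
  ∈-consequent⁻ ⊥' ()
  ∈-consequent⁻ (_ ∧ _) ()
  ∈-consequent⁻ (_ ∨ _) ()
  ∈-consequent⁻ (_ ⇒ _) ()

  ∈-consequent⁺ : ∀ {a a′ b} → Equivalent a a′ → b ∈ consequent a (a′ ▷ b)
  ∈-consequent⁺ {a} {a′} eq with equivalent? a a′
  ... | yes _ = here refl
  ... | no ¬eq = ⊥-elim (¬eq eq)

  ∈-consequents⁻ : ∀ {a b} Γ → b ∈ consequents a Γ → ∃[ a′ ] (a′ ▷ b) ∈ Γ × Equivalent a a′
  ∈-consequents⁻ {a} (x ∷ Γ) m with ∈-++⁻ (consequent a x) m
  ... | inj₁ m′ with ∈-consequent⁻ x m′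
  ...   | a′ , refl , eq = a′ , here refl , eq
  ∈-consequents⁻ (x ∷ Γ) m | inj₂ m′ = map₂ (map₁ there) (∈-consequents⁻ Γ m′)

  ∈-consequents⁺ : ∀ {a a′ b Γ} → (a′ ▷ b) ∈ Γ → Equivalent a a′ → b ∈ consequents a Γ
  ∈-consequents⁺ (here refl) eq = ∈-++⁺ˡ (∈-consequent⁺ eq)
  ∈-consequents⁺ {a} {Γ = x ∷ _} (there m) eq = ∈-++⁺ʳ (consequent a x) (∈-consequents⁺ m eq)

  consequents-⊆ : ∀ y a → consequents a (valued true y S) ⊆ S
  consequents-⊆ y a m with ∈-consequents⁻ (valued true y S) m
  ... | a′ , m′ , _ = ∈S⁺ (valued-⊆ true y S m′) (Sub⁺-right a′ _)

  depth-▷-rule : ∀ y {a b} → (a ▷ b) ∈ S → depth (⋀ (consequents a (valued true y S)) ⇒ b) < depth ψ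
  depth-▷-rule y {a} m = ⊔-<-lub (depth-⋀ _ (ℕ.≤-<-trans z≤n db) depth-consequent) db
    where
    db = proj₂ (depth-▷ m)

    depth-consequent : ∀ {x} → x ∈ consequents a (valued true y S) → depth x < depth ψ
    depth-consequent mx with ∈-consequents⁻ (valued true y S) mx
    ... | _ , m′ , _ = proj₂ (depth-▷ (valued-⊆ true y S m′))

  Derivable : Assignment → Set
  Derivable y = valued true y S ⊢ ⋁ (valued false y S)

  -- Each clause of Clash is a sequent rule, read backwards at χ, that closes
  -- the sequent of y.  The right rule for ⇒ demands y a ≡ false: then the
  -- assignments it quantifies over have strictly more true formulas in S,
  -- which is what makes Refuted decidable.
  mutual
    data Refuted (y : Assignment) : Set where
      refuted : ∀ {χ} → χ ∈ S → Clash y χ → Refuted y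

    Clash : Assignment → Form → Set
    Clash y (var _) = ⊥
    Clash y ⊥' = y ⊥' ≡ true
    Clash y (a ∧ b) = y (a ∧ b) ≡ true × (y a ≡ false ⊎ y b ≡ false)
                    ⊎ y (a ∧ b) ≡ false × y a ≡ true × y b ≡ true
    Clash y (a ∨ b) = y (a ∨ b) ≡ true × y a ≡ false × y b ≡ false
                    ⊎ y (a ∨ b) ≡ false × (y a ≡ true ⊎ y b ≡ true)
    Clash y (a ⇒ b) = y (a ⇒ b) ≡ true × y a ≡ true × y b ≡ false
                    ⊎ y (a ⇒ b) ≡ false × y b ≡ true
                    ⊎ y (a ⇒ b) ≡ false × y a ≡ false ×
                      (∀ z → Sat (a ∷ valued true y S) (b ∷ []) z → Refuted z)
    Clash y (a ▷ b) = y (a ▷ b) ≡ false × ICK (⋀ (consequents a (valued true y S)) ⇒ b)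

  refuted⇒derivable : ∀ {y} → Refuted y → Derivable y
  refuted⇒derivable {y} (refuted {χ} m c) = clash⇒derivable χ m c
    where
    true⊢ : ∀ {x} → x ∈ S → y x ≡ true → valued true y S ⊢ x
    true⊢ m e = hyp (∈-valued⁺ y m e)

    false⊢ : ∀ {x} → x ∈ S → y x ≡ false → valued true y S ⊢ x → Derivable y
    false⊢ m e = ⋁-intro (∈-valued⁺ y m e)

    clash⇒derivable : ∀ χ → χ ∈ S → Clash y χ → Derivable y
    clash⇒derivable ⊥' m e = explode (true⊢ m e)
    clash⇒derivable (a ∧ b) m (inj₁ (e , inj₁ ea)) =
      false⊢ (∈S⁺ m (Sub⁺-left a b)) ea (∧-elimˡ (true⊢ m e))
    clash⇒derivable (a ∧ b) m (inj₁ (e , inj₂ eb)) =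
      false⊢ (∈S⁺ m (Sub⁺-right a b)) eb (∧-elimʳ (true⊢ m e))
    clash⇒derivable (a ∧ b) m (inj₂ (e , ea , eb)) =
      false⊢ m e (∧-intro (true⊢ (∈S⁺ m (Sub⁺-left a b)) ea) (true⊢ (∈S⁺ m (Sub⁺-right a b)) eb))
    clash⇒derivable (a ∨ b) m (inj₁ (e , ea , eb)) =
      ∨-elim (true⊢ m e) (deduction (⋁-intro (∈-valued⁺ y (∈S⁺ m (Sub⁺-left a b)) ea) (hyp (here refl))))
                         (deduction (⋁-intro (∈-valued⁺ y (∈S⁺ m (Sub⁺-right a b)) eb) (hyp (here refl))))
    clash⇒derivable (a ∨ b) m (inj₂ (e , inj₁ ea)) =
      false⊢ m e (∨-introˡ (true⊢ (∈S⁺ m (Sub⁺-left a b)) ea))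
    clash⇒derivable (a ∨ b) m (inj₂ (e , inj₂ eb)) =
      false⊢ m e (∨-introʳ (true⊢ (∈S⁺ m (Sub⁺-right a b)) eb))
    clash⇒derivable (a ⇒ b) m (inj₁ (e , ea , eb)) =
      false⊢ (∈S⁺ m (Sub⁺-right a b)) eb (app (true⊢ m e) (true⊢ (∈S⁺ m (Sub⁺-left a b)) ea))
    clash⇒derivable (a ⇒ b) m (inj₂ (inj₁ (e , eb))) =
      false⊢ m e (app (thm (ax-K _ _)) (true⊢ (∈S⁺ m (Sub⁺-right a b)) eb))
    clash⇒derivable (a ⇒ b) m (inj₂ (inj₂ (e , _ , k))) =
      false⊢ m e (deduction (⋁-singleton (⊢-by-satisfying S (∈-∷⁺ʳ (∈S⁺ m (Sub⁺-left a b)) (valued-⊆ true y S))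
                                                         (∈-∷⁺ʳ (∈S⁺ m (Sub⁺-right a b)) λ ())
                                                         λ z s → refuted⇒derivable (k z s))))
    clash⇒derivable (a ▷ b) m (e , t) = false⊢ m e (app (thm (▷-mono a t)) (▷-⋀ a _ via-equivalent))
      where
      via-equivalent : ∀ {x} → x ∈ consequents a (valued true y S) → valued true y S ⊢ a ▷ x
      via-equivalent mx with ∈-consequents⁻ (valued true y S) mx
      ... | _ , m′ , (_ , a⇔a′) = ▷-congˡ a⇔a′ (hyp m′)

  Clash-agree : ∀ {y y′} → Agree S y y′ → ∀ χ → χ ∈ S → Clash y χ → Clash y′ χ
  Clash-agree {y} {y′} ag = transport
    where
    at : ∀ {x v} → x ∈ S → y x ≡ v → y′ x ≡ v
    at m = trans (sym (ag m))

    transport : ∀ χ → χ ∈ S → Clash y χ → Clash y′ χ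
    transport ⊥' m = at m
    transport (a ∧ b) m = Sum.map (Product.map (at m) (Sum.map (at ma) (at mb)))
                                  (Product.map (at m) (Product.map (at ma) (at mb)))
      where ma = ∈S⁺ m (Sub⁺-left a b) ; mb = ∈S⁺ m (Sub⁺-right a b)
    transport (a ∨ b) m = Sum.map (Product.map (at m) (Product.map (at ma) (at mb)))
                                  (Product.map (at m) (Sum.map (at ma) (at mb)))
      where ma = ∈S⁺ m (Sub⁺-left a b) ; mb = ∈S⁺ m (Sub⁺-right a b)
    transport (a ⇒ b) m =
      Sum.map (Product.map (at m) (Product.map (at ma) (at mb)))
              (Sum.map (Product.map (at m) (at mb))
                       (Product.map (at m) (Product.map (at ma) λ k z → k z ∘ subst (λ Γ → Sat (a ∷ Γ) (b ∷ []) z) trues)))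
      where ma = ∈S⁺ m (Sub⁺-left a b) ; mb = ∈S⁺ m (Sub⁺-right a b)
            trues = sym (valued-agree S ag)
    transport (a ▷ b) m = Product.map (at m) (subst (λ Γ → ICK (⋀ (consequents a Γ) ⇒ b)) (valued-agree S ag))

  Refuted-agree : ∀ {y y′} → Agree S y y′ → Refuted y → Refuted y′
  Refuted-agree ag (refuted m c) = refuted m (Clash-agree ag _ m c)

  μ : Assignment → ℕ
  μ y = length (valued false y S)

  Sat-extends : ∀ {y z a Δ} → Sat (a ∷ valued true y S) Δ z → y ⊑[ S ] z
  Sat-extends {y} s mx ex = All.lookup (All.tail (proj₁ s)) (∈-valued⁺ y mx ex)

  refuted-or-consistent : ∀ {Γ Δ} → Γ ⊆ S → Δ ⊆ S → (∀ z → Sat Γ Δ z → Dec (Refuted z)) →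
                          (∀ z → Sat Γ Δ z → Refuted z) ⊎ ∃[ z ] Sat Γ Δ z × ¬ Refuted z
  refuted-or-consistent {Γ} {Δ} Γ⊆S Δ⊆S refuted? with assignment-search S Q? Q-agree
    where
    Q? : ∀ z → Dec (Sat Γ Δ z → Refuted z)
    Q? z with Sat? Γ Δ z
    ... | no ¬s = yes (⊥-elim ∘ ¬s)
    ... | yes s = map′ (λ r _ → r) (λ f → f s) (refuted? z s)

    Q-agree : ∀ {z z′} → Agree S z z′ → (Sat Γ Δ z → Refuted z) → Sat Γ Δ z′ → Refuted z′
    Q-agree ag f = Refuted-agree ag ∘ f ∘ Sat-agree Γ⊆S Δ⊆S (λ m → sym (ag m))
  ... | inj₁ all = inj₁ all
  ... | inj₂ (z , ¬q) with Sat? Γ Δ z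
  ...   | yes s = inj₂ (z , s , λ r → ¬q λ _ → r)
  ...   | no ¬s = ⊥-elim (¬q (⊥-elim ∘ ¬s))

  ⇒-right? : ∀ y a b → (a ⇒ b) ∈ S → (∀ z → μ z < μ y → Dec (Refuted z)) →
             Dec (y (a ⇒ b) ≡ false × y a ≡ false × (∀ z → Sat (a ∷ valued true y S) (b ∷ []) z → Refuted z))
  ⇒-right? y a b m smaller? with y (a ⇒ b) ≟ᵇ false | y a ≟ᵇ false
  ... | no ¬e | _ = no (¬e ∘ proj₁)
  ... | yes _ | no ¬ea = no (¬ea ∘ proj₁ ∘ proj₂)
  ... | yes e | yes ea
    with refuted-or-consistent (∈-∷⁺ʳ ma (valued-⊆ true y S)) (∈-∷⁺ʳ (∈S⁺ m (Sub⁺-right a b)) λ ())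
                               (λ z s → smaller? z (falses-< {y} {z} S (Sat-extends {y} s) ma ea (All.head (proj₁ s))))
    where ma = ∈S⁺ m (Sub⁺-left a b)
  ...   | inj₁ all = yes (e , ea , all)
  ...   | inj₂ (z , s , ¬r) = no λ (_ , _ , all) → ¬r (all z s)

  Clash? : ∀ y χ → χ ∈ S → (∀ z → μ z < μ y → Dec (Refuted z)) → Dec (Clash y χ)
  Clash? y (var _) _ _ = no λ ()
  Clash? y ⊥' _ _ = y ⊥' ≟ᵇ true
  Clash? y (a ∧ b) _ _ = y (a ∧ b) ≟ᵇ true ×-dec (y a ≟ᵇ false ⊎-dec y b ≟ᵇ false)
                  ⊎-dec y (a ∧ b) ≟ᵇ false ×-dec y a ≟ᵇ true ×-dec y b ≟ᵇ true
  Clash? y (a ∨ b) _ _ = y (a ∨ b) ≟ᵇ true ×-dec y a ≟ᵇ false ×-dec y b ≟ᵇ false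
                  ⊎-dec y (a ∨ b) ≟ᵇ false ×-dec (y a ≟ᵇ true ⊎-dec y b ≟ᵇ true)
  Clash? y (a ⇒ b) m smaller? = y (a ⇒ b) ≟ᵇ true ×-dec y a ≟ᵇ true ×-dec y b ≟ᵇ false
                          ⊎-dec y (a ⇒ b) ≟ᵇ false ×-dec y b ≟ᵇ true
                          ⊎-dec ⇒-right? y a b m smaller?
  Clash? y (a ▷ b) m _ = y (a ▷ b) ≟ᵇ false ×-dec ICK-below? _ (depth-▷-rule y m)

  Refuted?-below : ∀ n y → μ y < n → Dec (Refuted y)
  Refuted?-below (suc n) y μy<1+n =
    map′ (λ (_ , m , c) → refuted m c) (λ { (refuted m c) → _ , m , c }) (any∈? S λ m → Clash? y _ m smaller?)
    where
    smaller? : ∀ z → μ z < μ y → Dec (Refuted z)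
    smaller? z μz<μy = Refuted?-below n z (ℕ.<-≤-trans μz<μy (ℕ.≤-pred μy<1+n))

  Refuted? : ∀ y → Dec (Refuted y)
  Refuted? y = Refuted?-below (suc (μ y)) y (ℕ.n<1+n _)

  Consistent : Assignment → Set
  Consistent y = ¬ Refuted y

  derivable-or-consistent : ∀ {Γ Δ} → Γ ⊆ S → Δ ⊆ S → Γ ⊢ ⋁ Δ ⊎ ∃[ z ] Sat Γ Δ z × Consistent z
  derivable-or-consistent Γ⊆S Δ⊆S with refuted-or-consistent Γ⊆S Δ⊆S (λ z _ → Refuted? z)
  ... | inj₁ all = inj₁ (⊢-by-satisfying S Γ⊆S Δ⊆S λ z s → refuted⇒derivable (all z s))
  ... | inj₂ c = inj₂ c

  entails⇒ICK : ∀ {c c′} → c ∈ S → c′ ∈ S →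
                (∀ w → Consistent w → w c ≡ true → w c′ ≡ true) → ICK (c ⇒ c′)
  entails⇒ICK mc mc′ entails with derivable-or-consistent (∈-∷⁺ʳ mc λ ()) (∈-∷⁺ʳ mc′ λ ())
  ... | inj₁ d = []⊢⇒ICK (deduction (⋁-singleton d))
  ... | inj₂ (w , (wc ∷ [] , wc′ ∷ []) , cw) = contradiction (trans (sym (entails w cw wc)) wc′) λ ()

  _≼_ : Assignment → Assignment → Set
  y ≼ z = y ⊑[ S ] z × (Consistent y → Consistent z)

  Represents : (Assignment → Set) → Form → Set
  Represents U a = ∀ w → Consistent w → (w a ≡ true → U w) × (U w → w a ≡ true)

  Reaches : (Assignment → Set) → Assignment → Assignment → Set
  Reaches U y z = (Consistent y → Consistent z) ×
                  (∀ {a b} → (a ▷ b) ∈ S → y (a ▷ b) ≡ true → Represents U a → z b ≡ true)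

  -- Refuted assignments remain worlds (none need be unrefuted to serve as
  -- point), but ≼ and Reaches never lead from an unrefuted world to a refuted one.
  frame : Frame lzero
  frame = record
    { X = Assignment
    ; _≤_ = _≼_
    ; ≤-refl = (λ _ → id) , id
    ; ≤-trans = λ (y⊑z , cz) (z⊑w , cw) → (λ m → z⊑w m ∘ y⊑z m) , cw ∘ cz
    ; point = λ _ → true
    ; R = Reaches ∘ proj₁
    ; R-ext = λ U U′ same y z (cz , k) → cz , λ m e rep → k m e λ w cw →
                proj₂ (same w) ∘ proj₁ (rep w cw) , proj₂ (rep w cw) ∘ proj₁ (same w)
    ; R-back = λ U (y⊑z , cz) (cw , k) → _ , (cw ∘ cz , λ m e → k m (y⊑z m e)) , ((λ _ → id) , id)
    }

  open Semantics frame

  V : Valuation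
  V n = (λ w → var n ∈ S × w (var n) ≡ true) , λ (y⊑z , _) (m , e) → m , y⊑z m e

  _⊩_ : Assignment → Form → Set
  y ⊩ χ = _⊨_ V y χ

  mutual
    truth : ∀ χ → χ ∈ S → ∀ {y} → Consistent y → y χ ≡ true → y ⊩ χ
    truth (var n) m cy e = m , e
    truth ⊥' m cy e = ⊥-elim (cy (refuted m e))
    truth (a ∧ b) m {y} cy e
      with ma ← ∈S⁺ m (Sub⁺-left a b) | mb ← ∈S⁺ m (Sub⁺-right a b) | y a in ea | y b in eb
    ... | false | _ = ⊥-elim (cy (refuted m (inj₁ (e , inj₁ ea))))
    ... | true | false = ⊥-elim (cy (refuted m (inj₁ (e , inj₂ eb))))
    ... | true | true = truth a ma cy ea , truth b mb cy eb
    truth (a ∨ b) m {y} cy e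
      with ma ← ∈S⁺ m (Sub⁺-left a b) | mb ← ∈S⁺ m (Sub⁺-right a b) | y a in ea | y b in eb
    ... | true | _ = inj₁ (truth a ma cy ea)
    ... | false | true = inj₂ (truth b mb cy eb)
    ... | false | false = ⊥-elim (cy (refuted m (inj₁ (e , ea , eb))))
    truth (a ⇒ b) m cy e z (y⊑z , cz) hz
      with ma ← ∈S⁺ m (Sub⁺-left a b) | mb ← ∈S⁺ m (Sub⁺-right a b) | z b in ezb
    ... | true = truth b mb (cz cy) ezb
    ... | false = ⊥-elim (cz cy (refuted m (inj₁ (y⊑z m e , ⊩⇒true a ma (cz cy) hz , ezb))))
    truth (a ▷ b) m cy e z (cz , k) =
      truth b (∈S⁺ m (Sub⁺-right a b)) (cz cy) (k m e λ w cw → truth a ma cw , ⊩⇒true a ma cw)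
      where ma = ∈S⁺ m (Sub⁺-left a b)

    ⊩⇒true : ∀ χ → χ ∈ S → ∀ {w} → Consistent w → w ⊩ χ → w χ ≡ true
    ⊩⇒true χ m {w} cw h with w χ in e
    ... | true = refl
    ... | false = ⊥-elim (falsity χ m cw e h)

    falsity : ∀ χ → χ ∈ S → ∀ {y} → Consistent y → y χ ≡ false → ¬ y ⊩ χ
    falsity (var n) m cy e (_ , e′) = contradiction (trans (sym e′) e) λ ()
    falsity ⊥' m cy e (lift ())
    falsity (a ∧ b) m {y} cy e (ha , hb)
      with ma ← ∈S⁺ m (Sub⁺-left a b) | mb ← ∈S⁺ m (Sub⁺-right a b) | y a in ea | y b in eb
    ... | false | _ = falsity a ma cy ea ha
    ... | true | false = falsity b mb cy eb hb
    ... | true | true = cy (refuted m (inj₂ (e , ea , eb)))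
    falsity (a ∨ b) m {y} cy e (inj₁ ha) with y a in ea
    ... | true = cy (refuted m (inj₂ (e , inj₁ ea)))
    ... | false = falsity a (∈S⁺ m (Sub⁺-left a b)) cy ea ha
    falsity (a ∨ b) m {y} cy e (inj₂ hb) with y b in eb
    ... | true = cy (refuted m (inj₂ (e , inj₂ eb)))
    ... | false = falsity b (∈S⁺ m (Sub⁺-right a b)) cy eb hb
    falsity (a ⇒ b) m {y} cy e h
      with ma ← ∈S⁺ m (Sub⁺-left a b) | mb ← ∈S⁺ m (Sub⁺-right a b) | y b in eb
    ... | true = cy (refuted m (inj₂ (inj₁ (e , eb))))
    ... | false with y a in ea
    ...   | true = falsity b mb cy eb (h y ((λ _ → id) , id) (truth a ma cy ea))
    ...   | false
      with refuted-or-consistent (∈-∷⁺ʳ ma (valued-⊆ true y S)) (∈-∷⁺ʳ mb λ ()) (λ z _ → Refuted? z)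
    ...     | inj₁ all = cy (refuted m (inj₂ (inj₂ (e , ea , all))))
    ...     | inj₂ (z , s , cz) =
                falsity b mb cz (All.head (proj₂ s))
                        (h z (Sat-extends {y} s , λ _ → cz) (truth a ma cz (All.head (proj₁ s))))
    falsity (a ▷ b) m {y} cy e h
      with ma ← ∈S⁺ m (Sub⁺-left a b) | mb ← ∈S⁺ m (Sub⁺-right a b) | ICK-below? _ (depth-▷-rule y m)
    ... | yes t = cy (refuted m (e , t))
    ... | no ¬t with derivable-or-consistent (consequents-⊆ y a) (∈-∷⁺ʳ mb λ ())
    ...   | inj₁ d = ¬t (⋀-deduction (⋁-singleton d))
    ...   | inj₂ (z , s , cz) = falsity b mb cz (All.head (proj₂ s)) (h z ((λ _ → cz) , reaches))
      where
      -- a′ defines the truth set of a on unrefuted worlds, so entails⇒ICK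
      -- makes it provably equivalent to a and b′ is among the consequents.
      reaches : ∀ {a′ b′} → (a′ ▷ b′) ∈ S → y (a′ ▷ b′) ≡ true → Represents (_⊩ a) a′ → z b′ ≡ true
      reaches {a′} {b′} m′ e′ represents =
        All.lookup (proj₁ s)
                   (∈-consequents⁺ (∈-valued⁺ y m′ e′) (depth-⇔ m m′ , ICK-⇔-intro a⇒a′ a′⇒a))
        where
        ma′ = ∈S⁺ m′ (Sub⁺-left a′ b′)
        a⇒a′ = entails⇒ICK ma ma′ λ w cw wa → proj₂ (represents w cw) (truth a ma cw wa)
        a′⇒a = entails⇒ICK ma′ ma λ w cw wa′ → ⊩⇒true a ma cw (proj₁ (represents w cw) wa′)

  ICK-or-countermodel : ICK ψ ⊎ ∃[ z ] Consistent z × z ψ ≡ false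
  ICK-or-countermodel with derivable-or-consistent (λ ()) (∈-∷⁺ʳ (here refl) λ ())
  ... | inj₁ d = inj₁ ([]⊢⇒ICK (⋁-singleton d))
  ... | inj₂ (z , (_ , zψ ∷ []) , cz) = inj₂ (z , cz , zψ)

  complete : ValidOn ψ → ICK ψ
  complete valid with ICK-or-countermodel
  ... | inj₁ t = t
  ... | inj₂ (z , cz , zψ) = ⊥-elim (falsity ψ (here refl) cz zψ (valid V z))

  ICK? : Dec (ICK ψ)
  ICK? with ICK-or-countermodel
  ... | inj₁ t = yes t
  ... | inj₂ (z , cz , zψ) = no λ t → falsity ψ (here refl) cz zψ (Soundness.ICK-sound frame t V z)

ICK?-below : ∀ n φ → depth φ < n → Dec (ICK φ)
ICK?-below (suc n) φ dφ<1+n =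
  Canonical.ICK? φ λ χ dχ<dφ → ICK?-below n χ (ℕ.<-≤-trans dχ<dφ (ℕ.≤-pred dφ<1+n))

ICK? : ∀ φ → Dec (ICK φ)
ICK? φ = ICK?-below (suc (depth φ)) φ (ℕ.n<1+n _)

theorem4p26 : ∀ (φ : Form) → ICK φ ↔ω Valid φ
theorem4p26 φ = record
  { to = λ t F → Soundness.ICK-sound F t
  ; from = λ valid → Canonical.complete φ below (valid (Canonical.frame φ below))
  }
  where
  below : ∀ χ → depth χ < depth φ → Dec (ICK χ)
  below χ _ = ICK? χ
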